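{- Fix $t\ge2$. For $n\ge1$ let $G_n^{(t)}$ be the $t$-uniform hypergraph on $\{1,\ldots,n\}$ whose hyperedges are the $t$-element pairwise coprime subsets. Let $c\ge1$ and $k_1,\ldots,k_c\ge t$, and let $R^{(t)\text{ -vertex}}_{\mathrm{cop}}(k_1,\ldots,k_c)$ be the least $n$ such that every coloring of $\{1,\ldots,n\}$ with colors $1,\ldots,c$ has, for some $i$, a set of $k_i$ vertices of color $i$ all of whose $t$-element subsets are hyperedges of $G_n^{(t)}$. Then $R^{(t)\text{ -vertex}}_{\mathrm{cop}}(k_1,\ldots,k_c)=p_{\sum_{i=1}^c(k_i-1)}$, where $p_m$ is the $m$-th prime ($p_1=2$).
   Context: A pairwise coprime set is a set of distinct positive integers any two of which are coprime. -}

module Defs where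

open import Data.Nat using (ℕ; zero; suc; _∸_; _≤_; _<_)
open import Data.Nat.ListAction using (sum)
open import Data.Nat.Primality using (Prime; prime?)
open import Data.Nat.Coprimality using (Coprime)
open import Data.Fin using (Fin; toℕ)
open import Data.List using (List; length; map; filter; upTo; allFin)
open import Data.List.Relation.Unary.All using (All)
open import Data.List.Relation.Unary.AllPairs using (AllPairs)
open import Data.List.Relation.Unary.Unique.Propositional using (Unique)
open import Data.List.Relation.Binary.Sublist.Propositional using (_⊆_)
open import Data.Product using (Σ; _×_)
open import Relation.Binary.PropositionalEquality using (_≡_)
open import Relation.Nullary using (¬_)

-- The vertex set {1,…,n} is represented by Fin n; the element i : Fin n
-- stands for the integer 1 + toℕ i.
label : {n : ℕ} → Fin n → ℕ
label i = suc (toℕ i)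

PairwiseCoprime : {n : ℕ} → List (Fin n) → Set
PairwiseCoprime xs = AllPairs (λ a b → Coprime (label a) (label b)) xs

-- A vertex set S (a duplicate-free list) spans a
-- "clique" in G_n^(t) iff every t-element subset of S (= every length-t
-- sublist of S) is a hyperedge.
IsTClique : (t : ℕ) {n : ℕ} → List (Fin n) → Set
IsTClique t S = ∀ (T : List _) → T ⊆ S → length T ≡ t → PairwiseCoprime T

ArrowsVertex : (t c : ℕ) (k : Fin c → ℕ) (n : ℕ) → Set
ArrowsVertex t c k n =
  (χ : Fin n → Fin c) →
  Σ (Fin c) λ i → Σ (List (Fin n)) λ S →
    Unique S × length S ≡ k i × All (λ v → χ v ≡ i) S × IsTClique t S

IsNthPrime : ℕ → ℕ → Set
IsNthPrime m p = Prime p × suc (length (filter prime? (upTo p))) ≡ m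

sumPred : (c : ℕ) → (Fin c → ℕ) → ℕ
sumPred c k = sum (map (λ i → k i ∸ 1) (allFin c))

-- Upper bound: the vertex 1 together with the primes up to p_m, m = Σ (k_i - 1),
-- are m + 1 pairwise coprime vertices, so by the weighted pigeonhole principle
-- some colour i receives k_i of them, and every t-subset of a pairwise coprime
-- set is a hyperedge.
-- Lower bound: for n < p_m, index the vertex 1 by 0 and a vertex a ≥ 2 by
-- 1 + π q, where q is a prime factor of a and π q counts the primes below q.
-- The indices are < m, and distinct coprime vertices get distinct indices.
-- Cut [0, m) into consecutive blocks of sizes k_i - 1 and colour a vertex by
-- the block of its index.  A monochromatic clique of colour i has k_i ≥ t ≥ 2
-- vertices and is pairwise coprime (each pair lies in a t-subset), so its
-- k_i indices are distinct and lie in a block of size k_i - 1: impossible.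
module Submission where

open import Level using (Level)
open import Data.Bool using (true; false; if_then_else_)
open import Data.Nat
  using (ℕ; zero; suc; _+_; _∸_; _≤_; _<_; _≰_; z≤n; s≤s; s≤s⁻¹; z<s; _≤?_; _<?_; _!;
         _≤′_; ≤′-refl; ≤′-step; NonZero; NonTrivial; nonTrivial⇒nonZero; nonTrivial⇒≢1; n>1⇒nonTrivial)
open import Data.Nat.Properties
  using (≤-refl; ≤-trans; ≤-antisym; ≤-<-trans; <⇒≤; <⇒≢; ≤⇒≯; ≮⇒≥; ≰⇒>; <⇒≤pred; ≤⇒≤′; <-cmp;
         +-mono-≤; +-comm; +-identityʳ; *-comm; m≤m+n; n<1+n; m≤n⇒m<n∨m≡n; m≤n⇒m⊓n≡m; 1≤n!;
         suc-injective; m+n∸m≡n; ∸-cancelʳ-≡; ∸-monoˡ-≤; ∸-monoˡ-<; ∸-monoʳ-<; +-*-semiring; module ≤-Reasoning)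
open import Algebra.Properties.Semiring.Sum +-*-semiring
  using (sum-syntax; ∑-distrib-+; sum-replicate-zero; sum-cong-≗)
open import Data.Nat.Divisibility using (_∣_; divides; ∣-trans; m∣m*n; m≤n⇒m!∣n!; ∣m+n∣m⇒∣n; ∣1⇒≡1; ∣⇒≤)
open import Data.Nat.Coprimality using (Coprime; prime⇒coprime; 1-coprimeTo) renaming (sym to coprime-sym)
open import Data.Nat.ListAction using (product) renaming (sum to sumList)
open import Data.Nat.Primality using (Prime; prime?; ¬prime[0]; ¬prime[1]; prime⇒nonZero)
open import Data.Nat.Primality.Factorisation using (factorise)
open import Data.Fin as Fin using (Fin; zero; suc; toℕ; fromℕ<) renaming (_<_ to _<ᶠ_)
open import Data.Fin.Properties
  using (_≟_; any?; 0≢1+n; toℕ-injective; toℕ<n; fromℕ<-injective) renaming (pigeonhole to Fin-pigeonhole)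
open import Data.List
  using (List; []; _∷_; _++_; [_]; length; map; filter; take; lookup; tabulate; applyUpTo; upTo; allFin)
open import Data.List.Properties
  using (map-tabulate; length-take; length-++; upTo-∷ʳ; filter-++; filter-accept; filter-reject)
open import Data.List.Membership.Propositional.Properties using (∈-lookup)
open import Data.List.Relation.Unary.All as All using (All; []; _∷_)
open import Data.List.Relation.Unary.All.Properties using (all-filter)
open import Data.List.Relation.Unary.AllPairs as AllPairs using (AllPairs; []; _∷_)
open import Data.List.Relation.Unary.Unique.Propositional using (Unique)
import Data.List.Relation.Unary.Unique.Propositional.Properties as Unique
open import Data.List.Relation.Binary.Sublist.Propositional using (_⊆_; []; _∷_; _∷ʳ_; ⊆-refl; ⊆-trans; from∈)
open import Data.List.Relation.Binary.Sublist.Propositional.Properties using (All-resp-⊆; take-⊆; filter-⊆)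
open import Data.Product using (Σ; ∃-syntax; _×_; _,_; proj₁; proj₂; map₁)
open import Data.Product.Properties using (×-≡,≡→≡)
open import Data.Sum using (inj₁; inj₂)
open import Function using (_∘_; id)
open import Relation.Binary.Definitions using (tri<; tri≈; tri>)
open import Relation.Binary.PropositionalEquality
  using (_≡_; _≢_; refl; sym; trans; cong; cong₂; subst; module ≡-Reasoning)
open import Relation.Nullary using (¬_; yes; no; does; contradiction)
open import Relation.Unary using (Decidable)
open import Defs

private variable
  a b r : Level
  A : Set a
  B : Set b

module _ {R : A → A → Set r} where

  AllPairs-resp-⊆ : ∀ {xs ys} → xs ⊆ ys → AllPairs R ys → AllPairs R xs
  AllPairs-resp-⊆ []         []         = []
  AllPairs-resp-⊆ (y ∷ʳ τ)   (_ ∷ pys)  = AllPairs-resp-⊆ τ pys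
  AllPairs-resp-⊆ (refl ∷ τ) (py ∷ pys) = All-resp-⊆ τ py ∷ AllPairs-resp-⊆ τ pys

  AllPairs-fromPairs : ∀ {xs} → (∀ {x y} → x ∷ y ∷ [] ⊆ xs → R x y) → AllPairs R xs
  AllPairs-fromPairs {[]}     _    = []
  AllPairs-fromPairs {x ∷ xs} pair =
    All.tabulate (λ y∈xs → pair (refl ∷ from∈ y∈xs)) ∷ AllPairs-fromPairs (pair ∘ (x ∷ʳ_))

  AllPairs-lookup : ∀ {xs} → AllPairs R xs → ∀ {i j} → i <ᶠ j → R (lookup xs i) (lookup xs j)
  AllPairs-lookup (Rx ∷ _)   {zero}  {suc j} _         = All.lookup Rx (∈-lookup j)
  AllPairs-lookup (_  ∷ Rxs) {suc i} {suc j} (s≤s i<j) = AllPairs-lookup Rxs i<j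

⊆-interpolate : ∀ {xs zs : List A} {m} → xs ⊆ zs → length xs ≤ m → m ≤ length zs →
                ∃[ ys ] xs ⊆ ys × ys ⊆ zs × length ys ≡ m
⊆-interpolate []         z≤n     z≤n     = [] , [] , [] , refl
⊆-interpolate (refl ∷ τ) (s≤s p) (s≤s q) =
  let ys , σ , ρ , ∣ys∣≡m = ⊆-interpolate τ p q in _ , refl ∷ σ , refl ∷ ρ , cong suc ∣ys∣≡m
⊆-interpolate (z ∷ʳ τ)   p       q       with m≤n⇒m<n∨m≡n q
... | inj₁ m<∣zs∣ =
  let ys , σ , ρ , ∣ys∣≡m = ⊆-interpolate τ p (s≤s⁻¹ m<∣zs∣) in ys , σ , z ∷ʳ ρ , ∣ys∣≡m
... | inj₂ m≡∣zs∣ = _ , z ∷ʳ τ , ⊆-refl , sym m≡∣zs∣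

AllPairs-fromSublists : ∀ {R : A → A → Set r} {xs m} → 2 ≤ m → m ≤ length xs →
                        (∀ ys → ys ⊆ xs → length ys ≡ m → AllPairs R ys) → AllPairs R xs
AllPairs-fromSublists {R = R} 2≤m m≤∣xs∣ h = AllPairs-fromPairs λ τ →
  let ys , σ , ρ , ∣ys∣≡m = ⊆-interpolate τ 2≤m m≤∣xs∣ in
  pairwise (AllPairs-resp-⊆ σ (h ys ρ ∣ys∣≡m))
  where
  pairwise : ∀ {x y} → AllPairs R (x ∷ y ∷ []) → R x y
  pairwise ((Rxy ∷ []) ∷ _) = Rxy

sumPred≡∑ : ∀ c (k : Fin c → ℕ) → sumPred c k ≡ ∑[ i < c ] (k i ∸ 1)
sumPred≡∑ zero    k = refl
sumPred≡∑ (suc c) k = cong ((k zero ∸ 1) +_) (begin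
  sumList (map k-1 (tabulate suc)) ≡⟨ cong sumList (map-tabulate suc k-1) ⟩
  sumList (tabulate (k-1 ∘ suc))   ≡⟨ cong sumList (map-tabulate id (k-1 ∘ suc)) ⟨
  sumPred c (k ∘ suc)              ≡⟨ sumPred≡∑ c (k ∘ suc) ⟩
  ∑[ i < c ] (k (suc i) ∸ 1)       ∎)
  where
  open ≡-Reasoning
  k-1 = λ i → k i ∸ 1

∑-mono-≤ : ∀ {n} {f g : Fin n → ℕ} → (∀ i → f i ≤ g i) → ∑[ i < n ] f i ≤ ∑[ i < n ] g i
∑-mono-≤ {zero}  _   = z≤n
∑-mono-≤ {suc n} f≤g = +-mono-≤ (f≤g zero) (∑-mono-≤ (f≤g ∘ suc))

δ : ∀ {c} → Fin c → Fin c → ℕ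
δ j i = if does (j ≟ i) then 1 else 0

∑-δ : ∀ {c} (j : Fin c) → ∑[ i < c ] δ j i ≡ 1
∑-δ {suc c} zero    = cong suc (sum-replicate-zero c)
∑-δ {suc c} (suc j) = ∑-δ j

module _ {c} (χ : A → Fin c) where

  count : Fin c → List A → ℕ
  count i xs = length (filter (λ x → χ x ≟ i) xs)

  count-∷ : ∀ i x xs → count i (x ∷ xs) ≡ δ (χ x) i + count i xs
  count-∷ i x xs with does (χ x ≟ i)
  ... | true  = refl
  ... | false = refl

  ∑-count : ∀ xs → ∑[ i < c ] count i xs ≡ length xs
  ∑-count []       = sum-replicate-zero c
  ∑-count (x ∷ xs) = begin
    ∑[ i < c ] count i (x ∷ xs)                  ≡⟨ sum-cong-≗ (λ i → count-∷ i x xs) ⟩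
    ∑[ i < c ] (δ (χ x) i + count i xs)          ≡⟨ ∑-distrib-+ (δ (χ x)) (λ i → count i xs) ⟩
    ∑[ i < c ] δ (χ x) i + ∑[ i < c ] count i xs ≡⟨ cong₂ _+_ (∑-δ (χ x)) (∑-count xs) ⟩
    1 + length xs                                ∎
    where open ≡-Reasoning

  pigeonhole : ∀ (k : Fin c → ℕ) xs → sumPred c k < length xs → ∃[ i ] k i ≤ count i xs
  pigeonhole k xs sumPred<∣xs∣ with any? (λ i → k i ≤? count i xs)
  ... | yes found = found
  ... | no  none  = contradiction sumPred<∣xs∣ (≤⇒≯ (begin
    length xs             ≡⟨ ∑-count xs ⟨
    ∑[ i < c ] count i xs ≤⟨ ∑-mono-≤ (λ i → <⇒≤pred (≰⇒> (none ∘ (i ,_)))) ⟩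
    ∑[ i < c ] (k i ∸ 1)  ≡⟨ sumPred≡∑ c k ⟨
    sumPred c k           ∎))
    where open ≤-Reasoning

-- block w ℓ = (i , o): ℓ is the o-th element of the i-th block when ℕ is cut
-- into consecutive blocks of sizes w 0, w 1, …; the last block is infinite.
block : ∀ {c} → (Fin (suc c) → ℕ) → ℕ → Fin (suc c) × ℕ
block {zero}  w ℓ = zero , ℓ
block {suc c} w ℓ with ℓ <? w zero
... | yes _ = zero , ℓ
... | no  _ = map₁ suc (block (w ∘ suc) (ℓ ∸ w zero))

block-injective : ∀ {c} (w : Fin (suc c) → ℕ) {ℓ ℓ′} → block w ℓ ≡ block w ℓ′ → ℓ ≡ ℓ′
block-injective {zero}  w eq = cong proj₂ eq
block-injective {suc c} w {ℓ} {ℓ′} eq with ℓ <? w zero | ℓ′ <? w zero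
... | yes _  | yes _   = cong proj₂ eq
... | yes _  | no  _   = contradiction (cong proj₁ eq) 0≢1+n
... | no  _  | yes _   = contradiction (cong proj₁ (sym eq)) 0≢1+n
... | no ℓ≮w | no ℓ′≮w =
  ∸-cancelʳ-≡ (≮⇒≥ ℓ≮w) (≮⇒≥ ℓ′≮w) (block-injective (w ∘ suc) (map₁-suc-injective eq))
  where
  map₁-suc-injective : ∀ {n} {p q : Fin n × ℕ} → map₁ (Fin.suc {n}) p ≡ map₁ Fin.suc q → p ≡ q
  map₁-suc-injective {p = _ , _} {q = _ , _} refl = refl

block-offset< : ∀ {c} (w : Fin (suc c) → ℕ) {ℓ} → ℓ < ∑[ i < suc c ] w i →
                proj₂ (block w ℓ) < w (proj₁ (block w ℓ))
block-offset< {zero}  w {ℓ} ℓ<∑w = subst (ℓ <_) (+-identityʳ (w zero)) ℓ<∑w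
block-offset< {suc c} w {ℓ} ℓ<∑w with ℓ <? w zero
... | yes ℓ<w = ℓ<w
... | no  ℓ≮w = block-offset< (w ∘ suc)
  (subst (ℓ ∸ w zero <_) (m+n∸m≡n (w zero) _) (∸-monoˡ-< ℓ<∑w (≮⇒≥ ℓ≮w)))

blockClass-length≤ : ∀ {c} (w : Fin (suc c) → ℕ) (ι : A → ℕ) → (∀ x → ι x < ∑[ i < suc c ] w i) →
                     ∀ {i xs} → All (λ x → proj₁ (block w (ι x)) ≡ i) xs →
                     AllPairs (λ x y → ι x ≢ ι y) xs → length xs ≤ w i
blockClass-length≤ w ι ι<∑w {i} {xs} coloured distinct = ≮⇒≥ λ wᵢ<∣xs∣ →
  let j , j′ , j<j′ , offsets≡ = Fin-pigeonhole wᵢ<∣xs∣ offset in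
  AllPairs-lookup distinct j<j′ (block-injective w (×-≡,≡→≡
    (trans (colour j) (sym (colour j′)) , fromℕ<-injective _ _ _ _ offsets≡)))
  where
  colour : ∀ j → proj₁ (block w (ι (lookup xs j))) ≡ i
  colour j = All.lookup coloured (∈-lookup j)
  offset : Fin (length xs) → Fin (w i)
  offset j = fromℕ< (subst (λ i → proj₂ (block w (ι (lookup xs j))) < w i) (colour j)
                       (block-offset< w (ι<∑w (lookup xs j))))

arrowsVertex-ofPairwiseCoprime : ∀ t c (k : Fin c → ℕ) {n} (xs : List (Fin n)) →
  Unique xs → PairwiseCoprime xs → sumPred c k < length xs → ArrowsVertex t c k n
arrowsVertex-ofPairwiseCoprime t c k xs xs-unique xs-coprime sumPred<∣xs∣ χ =
  i , S , AllPairs-resp-⊆ S⊆xs xs-unique , ∣S∣≡kᵢ ,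
  All-resp-⊆ (take-⊆ (k i) class) (all-filter (λ x → χ x ≟ i) xs) ,
  λ T T⊆S _ → AllPairs-resp-⊆ (⊆-trans T⊆S S⊆xs) xs-coprime
  where
  found = pigeonhole χ k xs sumPred<∣xs∣
  i = proj₁ found
  class = filter (λ x → χ x ≟ i) xs
  S = take (k i) class
  S⊆xs : S ⊆ xs
  S⊆xs = ⊆-trans (take-⊆ (k i) class) (filter-⊆ (λ x → χ x ≟ i) xs)
  ∣S∣≡kᵢ : length S ≡ k i
  ∣S∣≡kᵢ = trans (length-take (k i) class) (m≤n⇒m⊓n≡m (proj₂ found))

¬arrowsVertex-ofIndex : ∀ {t c} {k : Fin (suc c) → ℕ} {n} → 2 ≤ t → (∀ i → t ≤ k i) →
  (ι : Fin n → ℕ) → (∀ v → ι v < sumPred (suc c) k) →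
  (∀ {u v} → Coprime (label u) (label v) → ι u ≡ ι v → u ≡ v) →
  ¬ ArrowsVertex t (suc c) k n
¬arrowsVertex-ofIndex {t} {c} {k} 2≤t t≤k ι ι<sumPred ι-injective arrows =
  let i , S , S-unique , ∣S∣≡kᵢ , S-coloured , S-clique = arrows (proj₁ ∘ block w ∘ ι)
      S-coprime = AllPairs-fromSublists 2≤t (subst (t ≤_) (sym ∣S∣≡kᵢ) (t≤k i)) S-clique
      ∣S∣≤kᵢ∸1 = blockClass-length≤ w ι ι<∑w S-coloured (ι-distinct S-unique S-coprime)
      1≤kᵢ = ≤-trans (s≤s z≤n) (≤-trans 2≤t (t≤k i))
  in ≤⇒≯ ∣S∣≤kᵢ∸1 (subst (k i ∸ 1 <_) (sym ∣S∣≡kᵢ) (∸-monoʳ-< z<s 1≤kᵢ))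
  where
  w = λ i → k i ∸ 1
  ι<∑w : ∀ v → ι v < ∑[ i < suc c ] w i
  ι<∑w v = subst (ι v <_) (sumPred≡∑ (suc c) k) (ι<sumPred v)
  ι-distinct : ∀ {S} → Unique S → PairwiseCoprime S → AllPairs (λ u v → ι u ≢ ι v) S
  ι-distinct S-unique S-coprime = AllPairs.zipWith distinct (S-unique , S-coprime)
    where
    distinct : ∀ {u v} → u ≢ v × Coprime (label u) (label v) → ι u ≢ ι v
    distinct (u≢v , coprime) = u≢v ∘ ι-injective coprime

π : ℕ → ℕ
π n = length (filter prime? (upTo n))

π-suc : ∀ n → π (suc n) ≡ π n + length (filter prime? [ n ])
π-suc n = begin
  length (filter prime? (upTo (suc n)))                 ≡⟨ cong (length ∘ filter prime?) (upTo-∷ʳ n) ⟨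
  length (filter prime? (upTo n ++ [ n ]))               ≡⟨ cong length (filter-++ prime? (upTo n) [ n ]) ⟩
  length (filter prime? (upTo n) ++ filter prime? [ n ]) ≡⟨ length-++ (filter prime? (upTo n)) ⟩
  π n + length (filter prime? [ n ])                     ∎
  where open ≡-Reasoning

π-suc-prime : ∀ {n} → Prime n → π (suc n) ≡ suc (π n)
π-suc-prime {n} n-prime =
  trans (π-suc n) (trans (cong (λ ps → π n + length ps) (filter-accept prime? n-prime))
                         (+-comm (π n) 1))

π-suc-¬prime : ∀ {n} → ¬ Prime n → π (suc n) ≡ π n
π-suc-¬prime {n} ¬n-prime =
  trans (π-suc n) (trans (cong (λ ps → π n + length ps) (filter-reject prime? ¬n-prime))
                         (+-identityʳ (π n)))

π-mono-≤ : ∀ {m n} → m ≤ n → π m ≤ π n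
π-mono-≤ = π-mono-≤′ ∘ ≤⇒≤′
  where
  π-mono-≤′ : ∀ {m n} → m ≤′ n → π m ≤ π n
  π-mono-≤′ ≤′-refl = ≤-refl
  π-mono-≤′ {m} {suc n} (≤′-step m≤′n) =
    ≤-trans (π-mono-≤′ m≤′n) (subst (π n ≤_) (sym (π-suc n)) (m≤m+n (π n) _))

prime⇒π< : ∀ {q n} → Prime q → q < n → π q < π n
prime⇒π< q-prime q<n = subst (_≤ _) (π-suc-prime q-prime) (π-mono-≤ q<n)

π-injectiveOnPrimes : ∀ {p q} → Prime p → Prime q → π p ≡ π q → p ≡ q
π-injectiveOnPrimes {p} {q} p-prime q-prime πp≡πq with <-cmp p q
... | tri< p<q _ _ = contradiction πp≡πq (<⇒≢ (prime⇒π< p-prime p<q))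
... | tri≈ _ p≡q _ = p≡q
... | tri> _ _ q<p = contradiction (sym πp≡πq) (<⇒≢ (prime⇒π< q-prime q<p))

primeFactor : ∀ n → .{{NonTrivial n}} → ∃[ q ] Prime q × q ∣ n
primeFactor n with factorise n {{nonTrivial⇒nonZero n}}
... | record { factors = [] ; isFactorisation = n≡1 } = contradiction n≡1 nonTrivial⇒≢1
... | record { factors = q ∷ qs ; isFactorisation = n≡q*Πqs ; factorsPrime = q-prime ∷ _ } =
  q , q-prime , divides (product qs) (trans n≡q*Πqs (*-comm q (product qs)))

m≤n⇒m∣n! : ∀ {m n} → .{{NonZero m}} → m ≤ n → m ∣ n !
m≤n⇒m∣n! {suc m} m≤n = ∣-trans (m∣m*n (m !)) (m≤n⇒m!∣n! m≤n)

prime-above : ∀ N → ∃[ q ] Prime q × N < q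
prime-above N with primeFactor (suc (N !)) {{n>1⇒nonTrivial (s≤s (1≤n! N))}}
... | q , q-prime , q∣1+N! = q , q-prime , ≰⇒> q≰N
  where
  q≰N : q ≰ N
  q≰N q≤N = ¬prime[1] (subst Prime q≡1 q-prime)
    where
    q∣N! = m≤n⇒m∣n! {{prime⇒nonZero q-prime}} q≤N
    q≡1 = ∣1⇒≡1 (∣m+n∣m⇒∣n (subst (q ∣_) (+-comm 1 (N !)) q∣1+N!) q∣N!)

π-unbounded : ∀ m → ∃[ N ] m ≤ π N
π-unbounded zero    = 0 , z≤n
π-unbounded (suc m) with π-unbounded m
... | N , m≤πN with prime-above N
... | q , q-prime , N<q =
  suc q , subst (suc m ≤_) (sym (π-suc-prime q-prime)) (s≤s (≤-trans m≤πN (π-mono-≤ (<⇒≤ N<q))))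

nthPrime-below : ∀ {m} N → 1 ≤ m → m ≤ π N → ∃[ p ] IsNthPrime m p
nthPrime-below zero    1≤m m≤0 = contradiction (≤-trans 1≤m m≤0) λ ()
nthPrime-below {m} (suc N) 1≤m m≤π[1+N] with m ≤? π N | prime? N
... | yes m≤πN | _           = nthPrime-below N 1≤m m≤πN
... | no  m≰πN | yes N-prime =
  N , N-prime , ≤-antisym (≰⇒> m≰πN) (subst (m ≤_) (π-suc-prime N-prime) m≤π[1+N])
... | no  m≰πN | no ¬N-prime = contradiction (subst (m ≤_) (π-suc-¬prime ¬N-prime) m≤π[1+N]) m≰πN

nthPrime : ∀ {m} → 1 ≤ m → ∃[ p ] IsNthPrime m p
nthPrime {m} 1≤m = let N , m≤πN = π-unbounded m in nthPrime-below N 1≤m m≤πN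

primeIndex : ℕ → ℕ
primeIndex (suc (suc a)) = suc (π (proj₁ (primeFactor (2 + a))))
primeIndex _             = 0

primeIndex≤π : ∀ {a p} → a < p → primeIndex a ≤ π p
primeIndex≤π {zero}        _   = z≤n
primeIndex≤π {suc zero}    _   = z≤n
primeIndex≤π {suc (suc a)} a<p with primeFactor (2 + a)
... | q , q-prime , q∣a = prime⇒π< q-prime (≤-<-trans (∣⇒≤ q∣a) a<p)

primeIndex-injective : ∀ {a b} → Coprime (suc a) (suc b) →
                       primeIndex (suc a) ≡ primeIndex (suc b) → a ≡ b
primeIndex-injective {zero}  {zero}  _       _  = refl
primeIndex-injective {suc a} {suc b} coprime eq with primeFactor (2 + a) | primeFactor (2 + b)
... | q , q-prime , q∣a | r , r-prime , r∣b = contradiction (subst Prime q≡1 q-prime) ¬prime[1]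
  where
  q≡r = π-injectiveOnPrimes q-prime r-prime (suc-injective eq)
  q≡1 = coprime (q∣a , subst (_∣ 2 + b) (sym q≡r) r∣b)

coprime-ofDistinctPrimes : ∀ {p q} → Prime p → Prime q → p ≢ q → Coprime p q
coprime-ofDistinctPrimes {p} {q} p-prime q-prime p≢q with <-cmp p q
... | tri< p<q _ _ = coprime-sym (prime⇒coprime q-prime {{prime⇒nonZero p-prime}} p<q)
... | tri≈ _ p≡q _ = contradiction p≡q p≢q
... | tri> _ _ q<p = prime⇒coprime p-prime {{prime⇒nonZero q-prime}} q<p

length-filter-map : ∀ {p} {P : B → Set p} (P? : Decidable P) (f : A → B) xs →
                    length (filter P? (map f xs)) ≡ length (filter (P? ∘ f) xs)
length-filter-map P? f []       = refl
length-filter-map P? f (x ∷ xs) with does (P? (f x))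
... | true  = cong suc (length-filter-map P? f xs)
... | false = length-filter-map P? f xs

tabulate-toℕ : ∀ n (f : ℕ → A) → tabulate {n = n} (f ∘ toℕ) ≡ applyUpTo f n
tabulate-toℕ zero    f = refl
tabulate-toℕ (suc n) f = cong (f 0 ∷_) (tabulate-toℕ n (f ∘ suc))

label-injective : ∀ {n} {u v : Fin n} → label u ≡ label v → u ≡ v
label-injective = toℕ-injective ∘ suc-injective

pairwiseCoprime-ofPrimes : ∀ {n} {xs : List (Fin n)} →
                           Unique xs → All (Prime ∘ label) xs → PairwiseCoprime xs
pairwiseCoprime-ofPrimes                []                 []                   = []
pairwiseCoprime-ofPrimes {xs = x ∷ _} (x∉xs ∷ xs-unique) (x-prime ∷ xs-prime) =
  All.zipWith coprime (x∉xs , xs-prime) ∷ pairwiseCoprime-ofPrimes xs-unique xs-prime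
  where
  coprime : ∀ {y} → x ≢ y × Prime (label y) → Coprime (label x) (label y)
  coprime (x≢y , y-prime) = coprime-ofDistinctPrimes x-prime y-prime (x≢y ∘ label-injective)

primeVertices : ∀ n → List (Fin n)
primeVertices n = filter (prime? ∘ label) (allFin n)

length-primeVertices : ∀ n → length (primeVertices n) ≡ π (suc n)
length-primeVertices n = begin
  length (filter (prime? ∘ label) (allFin n))   ≡⟨ length-filter-map prime? label (allFin n) ⟨
  length (filter prime? (map label (allFin n))) ≡⟨ cong (length ∘ filter prime?) label-list ⟩
  π (suc n)                                     ∎
  where
  open ≡-Reasoning
  label-list = trans (map-tabulate id label) (tabulate-toℕ n suc)

oneAndPrimes : ∀ n → List (Fin (suc n))
oneAndPrimes n = zero ∷ primeVertices (suc n)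

oneAndPrimes-unique : ∀ n → Unique (oneAndPrimes n)
oneAndPrimes-unique n =
  All.map (λ v-prime v≡0 → ¬prime[1] (subst (Prime ∘ label) (sym v≡0) v-prime))
          (all-filter (prime? ∘ label) (allFin (suc n)))
  ∷ Unique.filter⁺ (prime? ∘ label) (Unique.allFin⁺ (suc n))

oneAndPrimes-pairwiseCoprime : ∀ n → PairwiseCoprime (oneAndPrimes n)
oneAndPrimes-pairwiseCoprime n =
  All.universal (1-coprimeTo ∘ label) (primeVertices (suc n))
  ∷ pairwiseCoprime-ofPrimes (Unique.filter⁺ (prime? ∘ label) (Unique.allFin⁺ (suc n)))
                             (all-filter (prime? ∘ label) (allFin (suc n)))

arrowsVertex-atNthPrime : ∀ t c k {p} → IsNthPrime (sumPred c k) p → ArrowsVertex t c k p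
arrowsVertex-atNthPrime t c k {zero}  (0-prime , _)        = contradiction 0-prime ¬prime[0]
arrowsVertex-atNthPrime t c k {suc p} (p-prime , 1+πp≡m) =
  arrowsVertex-ofPairwiseCoprime t c k (oneAndPrimes p)
    (oneAndPrimes-unique p) (oneAndPrimes-pairwiseCoprime p)
    (subst (_< length (oneAndPrimes p)) 1+πp≡m (s≤s (subst (suc (π (suc p)) ≤_)
      (sym (length-primeVertices (suc p))) (prime⇒π< p-prime (n<1+n (suc p))))))

¬arrowsVertex-belowNthPrime : ∀ {t c} {k : Fin (suc c) → ℕ} {p n} → 2 ≤ t → (∀ i → t ≤ k i) →
  IsNthPrime (sumPred (suc c) k) p → n < p → ¬ ArrowsVertex t (suc c) k n
¬arrowsVertex-belowNthPrime 2≤t t≤k (_ , 1+πp≡m) n<p =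
  ¬arrowsVertex-ofIndex 2≤t t≤k (primeIndex ∘ label)
    (λ v → subst (primeIndex (label v) <_) 1+πp≡m (s≤s (primeIndex≤π (≤-<-trans (toℕ<n v) n<p))))
    (λ coprime eq → toℕ-injective (primeIndex-injective coprime eq))

corollary4p8 : (t : ℕ) → 2 ≤ t → (c : ℕ) → 1 ≤ c → (k : Fin c → ℕ) → (∀ i → t ≤ k i) →
    Σ ℕ λ p → IsNthPrime (sumPred c k) p × ArrowsVertex t c k p ×
      (∀ n → 1 ≤ n → n < p → ¬ ArrowsVertex t c k n)
corollary4p8 t 2≤t (suc c) _ k t≤k =
  let p , p-nth = nthPrime 1≤sumPred in
  p , p-nth , arrowsVertex-atNthPrime t (suc c) k p-nth ,
  λ n _ n<p → ¬arrowsVertex-belowNthPrime 2≤t t≤k p-nth n<p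
  where
  1≤sumPred : 1 ≤ sumPred (suc c) k
  1≤sumPred = subst (1 ≤_) (sym (sumPred≡∑ (suc c) k))
    (≤-trans (∸-monoˡ-≤ 1 (≤-trans 2≤t (t≤k zero))) (m≤m+n _ _))
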